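{- Let $G=(V,E)$ be a simple connected graph. Consider a procedure that first embeds a spanning tree of $G$ and then inserts the remaining edges of $G$ one at a time into the current partial embedding. In each step it inserts an edge that is not critical for the current partial embedding only if the current partial embedding has no critical edge. Let $G'=(V',E')$ be an embedded subgraph produced at some stage of this procedure that contains at least one cycle. Let $e$ be the last edge that, during the construction of $G'$, was inserted into a single face $f$, thereby splitting $f$ into two faces with vertex sets $f^v_1$ and $f^v_2$. If there is an edge $e_c$ that is critical for $G'$, then $|e_c\cap(f^v_1\setminus f^v_2)|=|e_c\cap(f^v_2\setminus f^v_1)|=1$.
   Context: Embeddings are orientable embeddings given by rotation systems. Each undirected edge corresponds to two oppositely directed edges, and each vertex has a cyclic (clockwise) ordering of the directed edges starting at it. Faces are determined by face tracing: from a directed edge $(v,w)$ go to $(w,v)$, then to the next edge in the cyclic order at $w$, and repeat until returning to $(v,w)$. For a face $f$, $f^v$ denotes the set of vertices occurring in its directed edges. Inserting an edge $\{x,y\}$ into a partial embedding means placing it into an angle at $x$ and an angle at $y$. If both angles belong to the same face $f$, the edge is said to be inserted into the face $f$, and $f$ is split into two faces whose vertex sets have union $f^v$. If the two angles belong to different faces, those faces are merged into one. An edge of $G$ that is not yet embedded, regarded as its set of two end vertices, is critical for a partial embedding if no face $f$ of that embedding satisfies that both end vertices lie in $f^v$; that is, it cannot be inserted into any existing face. -}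

module Defs where

open import Data.Nat using (ℕ; zero; suc; _≤_; _<_)
open import Data.Fin using (Fin)
open import Data.Fin.Properties using (_≟_)
open import Data.List using (List; []; _∷_; _++_; [_]; length)
open import Data.List.Membership.Propositional using (_∈_; _∉_)
open import Data.List.Relation.Unary.Linked using (Linked)
open import Data.List.Relation.Unary.Unique.Propositional using (Unique)
open import Data.Product using (Σ; ∃; _×_; _,_; proj₁; proj₂)
open import Data.Sum using (_⊎_)
open import Relation.Nullary using (¬_; yes; no)
open import Relation.Binary.PropositionalEquality using (_≡_)
open import Relation.Binary.Construct.Closure.ReflexiveTransitive using (Star)

record Graph (n : ℕ) : Set₁ where
  field
    Adj     : Fin n → Fin n → Set
    sym     : ∀ {u v} → Adj u v → Adj v u
    noLoops : ∀ {u} → ¬ Adj u u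
open Graph public

Connected : ∀ {n} → Graph n → Set
Connected G = ∀ u v → Star (Adj G) u v

-- Since all graphs are simple, a directed edge (dart)
-- (v , w) is determined by its ends.  R v lists the neighbours w of v in the
-- clockwise cyclic order of the darts (v , w) at v.

Rot : ℕ → Set
Rot n = Fin n → List (Fin n)

Dart : ℕ → Set
Dart n = Fin n × Fin n

EAdj : ∀ {n} → Rot n → Fin n → Fin n → Set
EAdj R v w = w ∈ R v

IsDart : ∀ {n} → Rot n → Dart n → Set
IsDart R (v , w) = EAdj R v w

WellFormed : ∀ {n} → Rot n → Set
WellFormed R = (∀ v → Unique (R v))
             × (∀ v w → EAdj R v w → EAdj R w v)
             × (∀ v → ¬ EAdj R v v)

-- cyclic successor of a in the cyclic list l (identity if a ∉ l).
-- nextGo h a c r : successor of a in the list c ∷ r, wrapping around to h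
-- after the last element
nextGo : ∀ {n} → Fin n → Fin n → Fin n → List (Fin n) → Fin n
nextGo h a c [] with c ≟ a
... | yes _ = h
... | no  _ = a
nextGo h a c (d ∷ r) with c ≟ a
... | yes _ = d
... | no  _ = nextGo h a d r

next : ∀ {n} → List (Fin n) → Fin n → Fin n
next [] a = a
next (h ∷ t) a = nextGo h a h t

-- face tracing: from (v , w) go to (w , v), then to the next dart at w
φ : ∀ {n} → Rot n → Dart n → Dart n
φ R (v , w) = (w , next (R w) v)

iter : ∀ {A : Set} → (A → A) → ℕ → A → A
iter f zero    x = x
iter f (suc k) x = f (iter f k x)

-- x ∈ f^v, where f is the face (orbit of face tracing) containing dart d
OnFace : ∀ {n} → Rot n → Dart n → Fin n → Set
OnFace R d x = ∃ λ k → proj₁ (iter (φ R) k d) ≡ x ⊎ proj₂ (iter (φ R) k d) ≡ x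

SameFace : ∀ {n} → Rot n → Dart n → Dart n → Set
SameFace R d d' = ∃ λ k → iter (φ R) k d ≡ d'

HasCycle : ∀ {n} → Rot n → Set
HasCycle {n} R = Σ (Fin n) λ v → Σ (List (Fin n)) λ rest →
  (2 ≤ length rest) × Unique (v ∷ rest) × Linked (EAdj R) ((v ∷ rest) ++ [ v ])

SpanningTreeEmb : ∀ {n} → Graph n → Rot n → Set
SpanningTreeEmb G R = WellFormed R
                    × (∀ v w → EAdj R v w → Adj G v w)
                    × (∀ u v → Star (EAdj R) u v)
                    × ¬ HasCycle R

-- A move (x , a , y , b) inserts the edge {x , y} into the
-- angle at x following the dart (x , a) and into the angle at y following the
-- dart (y , b).  The angle at x between (x , a) and (x , next a) belongs to
-- the face containing the dart (a , x).

Move : ℕ → Set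
Move n = Fin n × Fin n × Fin n × Fin n

insertAfter : ∀ {n} → Fin n → Fin n → List (Fin n) → List (Fin n)
insertAfter a y [] = []
insertAfter a y (c ∷ r) with c ≟ a
... | yes _ = c ∷ y ∷ r
... | no  _ = c ∷ insertAfter a y r

apply : ∀ {n} → Rot n → Move n → Rot n
apply R (x , a , y , b) v with v ≟ x
... | yes _ = insertAfter a y (R v)
... | no  _ with v ≟ y
...   | yes _ = insertAfter b x (R v)
...   | no  _ = R v

stage : ∀ {n} → Rot n → (ℕ → Move n) → ℕ → Rot n
stage R₀ ms zero    = R₀
stage R₀ ms (suc i) = apply (stage R₀ ms i) (ms i)

-- an edge {u , w} of G not yet embedded that cannot be inserted into any face
Critical : ∀ {n} → Graph n → Rot n → Fin n → Fin n → Set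
Critical G R u w = Adj G u w × ¬ EAdj R u w
                 × ¬ (∃ λ d → IsDart R d × OnFace R d u × OnFace R d w)

ValidStep : ∀ {n} → Graph n → Rot n → Move n → Set
ValidStep G R (x , a , y , b) =
  Adj G x y × ¬ EAdj R x y × a ∈ R x × b ∈ R y
  × (¬ Critical G R x y → ∀ u w → ¬ Critical G R u w)

IntoFace : ∀ {n} → Rot n → Move n → Set
IntoFace R (x , a , y , b) = SameFace R (a , x) (b , y)

-- the two faces created by splitting: f₁ ∋ (x , y), f₂ ∋ (y , x) in the new embedding
F₁ F₂ : ∀ {n} → Rot n → Move n → Fin n → Set
F₁ R (x , a , y , b) = OnFace (apply R (x , a , y , b)) (x , y)
F₂ R (x , a , y , b) = OnFace (apply R (x , a , y , b)) (y , x)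

-- |{u , w} ∩ S| = 1   (for u ≠ w)
ExactlyOne : ∀ {n} → (Fin n → Set) → Fin n → Fin n → Set
ExactlyOne S u w = (S u × ¬ S w) ⊎ (¬ S u × S w)

_∖_ : ∀ {n} → (Fin n → Set) → (Fin n → Set) → Fin n → Set
(S ∖ T) v = S v × ¬ T v

module Submission where

-- Let R be stage j and R' stage j+1, obtained by inserting {x , y} behind the
-- darts A = (a , x) and B = (b , y).  Face tracing in R' agrees with that in
-- R except that A ↦ (x , y) ↦ φ B and B ↦ (y , x) ↦ φ A (Section 4).  An
-- abstract "orbit surgery" argument (Section 2) shows: inserting into one face
-- splits it, its vertices falling on F₁ ∋ (x , y) or F₂ ∋ (y , x), while the
-- other faces survive; inserting between two faces only merges faces.
-- For a critical {u , w} of stage m: all steps after j merge, so u and w share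
-- no face of stage j+1, hence are not both on F₁ nor both on F₂.  The edge
-- {x , y} was not critical at stage j, so by the rule of the procedure neither
-- was {u , w}: they shared a face of stage j, which must be the split one, so
-- each of u, w lies on F₁ or F₂.  As φ permutes a finite set, faces are
-- decidable (Section 3) and a case analysis concludes (Section 5).

open import Defs hiding (sym)
open import Data.Nat using (ℕ; zero; suc; _+_; _*_; _∸_; _<_; _≤_; z≤n; _≤′_; ≤′-refl; ≤′-step)
open import Data.Nat.Properties using (n<1+n; m+[n∸m]≡n; +-suc; ≤⇒≤′; ≤′⇒≤; ≤-trans; n≤1+n; ≤-refl)
open import Data.Nat.DivMod using (_%_; _/_; m≡m%n+[m/n]*n; m%n<n)
open import Data.Fin using (Fin; toℕ; fromℕ<; combine)
open import Data.Fin.Properties using (_≟_; pigeonhole; combine-injectiveˡ; combine-injectiveʳ; any?; toℕ-fromℕ<)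
open import Data.List using (List; []; _∷_; _++_; [_])
open import Data.List.Membership.Propositional using (_∈_; _∉_)
open import Data.List.Membership.Propositional.Properties using (∈-++⁻)
open import Data.List.Relation.Unary.Any using (here; there)
open import Data.List.Relation.Unary.All using (_∷_)
open import Data.List.Relation.Unary.All.Properties using (¬Any⇒All¬)
open import Data.List.Relation.Unary.AllPairs using ([]; _∷_)
open import Data.List.Relation.Unary.Unique.Propositional using (Unique)
open import Data.List.Relation.Unary.Unique.Propositional.Properties using (Unique[x∷xs]⇒x∉xs)
open import Data.Product using (∃; _×_; _,_; proj₁; proj₂)
open import Data.Product.Properties using (≡-dec)
open import Data.Sum using (_⊎_; inj₁; inj₂; [_,_]′)
open import Data.Empty using (⊥-elim)
open import Relation.Nullary using (¬_; yes; no; Dec)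
open import Relation.Nullary.Decidable using (_⊎-dec_)
open import Relation.Binary.Definitions using (DecidableEquality)
open import Relation.Binary.PropositionalEquality using (_≡_; refl; sym; trans; cong; cong₂; subst; module ≡-Reasoning)

-- 1. Cyclic successors in duplicate-free lists and their behaviour under
--    insertAfter.

module CyclicList {n : ℕ} where

  open import Data.List.Membership.DecPropositional (_≟_ {n}) using (_∈?_)

  -- the four defining equations of nextGo, usable without matching on _≟_
  nextGo-hit : ∀ {h a c d : Fin n} {r} → c ≡ a → nextGo h a c (d ∷ r) ≡ d
  nextGo-hit {a = a} {c = c} c≡a with c ≟ a
  ... | yes _ = refl
  ... | no c≢a = ⊥-elim (c≢a c≡a)

  nextGo-skip : ∀ {h a c d : Fin n} {r} → ¬ c ≡ a → nextGo h a c (d ∷ r) ≡ nextGo h a d r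
  nextGo-skip {a = a} {c = c} c≢a with c ≟ a
  ... | yes c≡a = ⊥-elim (c≢a c≡a)
  ... | no _ = refl

  nextGo-hit[] : ∀ {h a c : Fin n} → c ≡ a → nextGo h a c [] ≡ h
  nextGo-hit[] {a = a} {c = c} c≡a with c ≟ a
  ... | yes _ = refl
  ... | no c≢a = ⊥-elim (c≢a c≡a)

  nextGo-skip[] : ∀ {h a c : Fin n} → ¬ c ≡ a → nextGo h a c [] ≡ a
  nextGo-skip[] {a = a} {c = c} c≢a with c ≟ a
  ... | yes c≡a = ⊥-elim (c≢a c≡a)
  ... | no _ = refl

  ∈-tail : ∀ {z c : Fin n} {r} → z ∈ c ∷ r → ¬ c ≡ z → z ∈ r
  ∈-tail (here z≡c) c≢z = ⊥-elim (c≢z (sym z≡c))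
  ∈-tail (there z∈r) _ = z∈r

  nextGo-∉ : ∀ (h a c : Fin n) r → a ∉ c ∷ r → nextGo h a c r ≡ a
  nextGo-∉ h a c [] a∉ = nextGo-skip[] (λ c≡a → a∉ (here (sym c≡a)))
  nextGo-∉ h a c (d ∷ r) a∉ =
    trans (nextGo-skip (λ c≡a → a∉ (here (sym c≡a)))) (nextGo-∉ h a d r (λ a∈ → a∉ (there a∈)))

  next-∉ : ∀ (l : List (Fin n)) a → a ∉ l → next l a ≡ a
  next-∉ [] a _ = refl
  next-∉ (h ∷ t) a a∉ = nextGo-∉ h a h t a∉

  nextGo-∈ : ∀ (h a c : Fin n) r → a ∈ c ∷ r → nextGo h a c r ∈ r ++ [ h ]
  nextGo-∈ h a c [] a∈ with c ≟ a
  ... | yes _ = here refl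
  ... | no c≢a with ∈-tail a∈ c≢a
  ...   | ()
  nextGo-∈ h a c (d ∷ r) a∈ with c ≟ a
  ... | yes _ = here refl
  ... | no c≢a = there (nextGo-∈ h a d r (∈-tail a∈ c≢a))

  next-∈ : ∀ (l : List (Fin n)) a → a ∈ l → next l a ∈ l
  next-∈ (h ∷ t) a a∈ with ∈-++⁻ t (nextGo-∈ h a h t a∈)
  ... | inj₁ s∈t = there s∈t
  ... | inj₂ (here s≡h) = here s≡h

  nextGo-≢-first : ∀ (h a d : Fin n) r → Unique (d ∷ r) → h ∉ d ∷ r → a ∈ d ∷ r →
                   ¬ nextGo h a d r ≡ d
  nextGo-≢-first h a d r u h∉ a∈ s≡d with ∈-++⁻ r (subst (_∈ r ++ [ h ]) s≡d (nextGo-∈ h a d r a∈))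
  ... | inj₁ d∈r = Unique[x∷xs]⇒x∉xs u d∈r
  ... | inj₂ (here d≡h) = h∉ (here (sym d≡h))

  nextGo-injective : ∀ (h a a' c : Fin n) r → Unique (c ∷ r) → h ∉ r → a ∈ c ∷ r → a' ∈ c ∷ r →
                     nextGo h a c r ≡ nextGo h a' c r → a ≡ a'
  nextGo-injective h a a' c [] _ _ (here a≡c) (here a'≡c) _ = trans a≡c (sym a'≡c)
  nextGo-injective h a a' c (d ∷ r) (_ ∷ u) h∉ a∈ a'∈ eq with c ≟ a | c ≟ a'
  ... | yes c≡a | yes c≡a' = trans (sym c≡a) c≡a'
  ... | yes _ | no c≢a' = ⊥-elim (nextGo-≢-first h a' d r u h∉ (∈-tail a'∈ c≢a') (sym eq))
  ... | no c≢a | yes _ = ⊥-elim (nextGo-≢-first h a d r u h∉ (∈-tail a∈ c≢a) eq)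
  ... | no c≢a | no c≢a' =
    nextGo-injective h a a' d r u (λ h∈r → h∉ (there h∈r)) (∈-tail a∈ c≢a) (∈-tail a'∈ c≢a') eq

  next-∈-∉ : ∀ (l : List (Fin n)) a a' → a ∈ l → a' ∉ l → ¬ next l a ≡ next l a'
  next-∈-∉ l a a' a∈ a'∉ eq = a'∉ (subst (_∈ l) (trans eq (next-∉ l a' a'∉)) (next-∈ l a a∈))

  next-injective : ∀ (l : List (Fin n)) → Unique l → ∀ a a' → next l a ≡ next l a' → a ≡ a'
  next-injective [] _ a a' eq = eq
  next-injective l@(h ∷ t) u a a' eq with a ∈? l | a' ∈? l
  ... | yes a∈ | yes a'∈ = nextGo-injective h a a' h t u (Unique[x∷xs]⇒x∉xs u) a∈ a'∈ eq
  ... | yes a∈ | no a'∉ = ⊥-elim (next-∈-∉ l a a' a∈ a'∉ eq)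
  ... | no a∉ | yes a'∈ = ⊥-elim (next-∈-∉ l a' a a'∈ a∉ (sym eq))
  ... | no a∉ | no a'∉ = trans (sym (next-∉ l a a∉)) (trans eq (next-∉ l a' a'∉))

  insertTail : Fin n → Fin n → Fin n → List (Fin n) → List (Fin n)
  insertTail a y c r with c ≟ a
  ... | yes _ = y ∷ r
  ... | no _ = insertAfter a y r

  insertAfter-∷ : ∀ (a y c : Fin n) r → insertAfter a y (c ∷ r) ≡ c ∷ insertTail a y c r
  insertAfter-∷ a y c r with c ≟ a
  ... | yes _ = refl
  ... | no _ = refl

  nextGo-insert-anchor : ∀ (h a y c : Fin n) r → a ∈ c ∷ r → nextGo h a c (insertTail a y c r) ≡ y
  nextGo-insert-anchor h a y c r a∈ with c ≟ a
  ... | yes c≡a = nextGo-hit c≡a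
  nextGo-insert-anchor h a y c [] a∈ | no c≢a with ∈-tail a∈ c≢a
  ... | ()
  nextGo-insert-anchor h a y c (d ∷ r) a∈ | no c≢a = begin
    nextGo h a c (insertAfter a y (d ∷ r))   ≡⟨ cong (nextGo h a c) (insertAfter-∷ a y d r) ⟩
    nextGo h a c (d ∷ insertTail a y d r)    ≡⟨ nextGo-skip c≢a ⟩
    nextGo h a d (insertTail a y d r)        ≡⟨ nextGo-insert-anchor h a y d r (∈-tail a∈ c≢a) ⟩
    y                                        ∎
    where open ≡-Reasoning

  nextGo-insert-new : ∀ (h a y c : Fin n) r → a ∈ c ∷ r → y ∉ c ∷ r →
                      nextGo h y c (insertTail a y c r) ≡ nextGo h a c r
  nextGo-insert-new h a y c r a∈ y∉ with c ≟ a
  nextGo-insert-new h a y c [] a∈ y∉ | yes c≡a =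
    trans (nextGo-skip (λ c≡y → y∉ (here (sym c≡y)))) (trans (nextGo-hit[] {h} {y} {y} refl) (sym (nextGo-hit[] c≡a)))
  nextGo-insert-new h a y c (d ∷ r) a∈ y∉ | yes c≡a =
    trans (nextGo-skip (λ c≡y → y∉ (here (sym c≡y)))) (trans (nextGo-hit {h} {y} {y} refl) (sym (nextGo-hit c≡a)))
  nextGo-insert-new h a y c [] a∈ y∉ | no c≢a with ∈-tail a∈ c≢a
  ... | ()
  nextGo-insert-new h a y c (d ∷ r) a∈ y∉ | no c≢a = begin
    nextGo h y c (insertAfter a y (d ∷ r))   ≡⟨ cong (nextGo h y c) (insertAfter-∷ a y d r) ⟩
    nextGo h y c (d ∷ insertTail a y d r)    ≡⟨ nextGo-skip (λ c≡y → y∉ (here (sym c≡y))) ⟩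
    nextGo h y d (insertTail a y d r)        ≡⟨ nextGo-insert-new h a y d r (∈-tail a∈ c≢a) (λ y∈ → y∉ (there y∈)) ⟩
    nextGo h a d r                           ≡⟨ sym (nextGo-skip c≢a) ⟩
    nextGo h a c (d ∷ r)                     ∎
    where open ≡-Reasoning

  nextGo-insert-other : ∀ (h a y c v : Fin n) r → ¬ v ≡ a → ¬ v ≡ y →
                        nextGo h v c (insertTail a y c r) ≡ nextGo h v c r
  nextGo-insert-other h a y c v r v≢a v≢y with c ≟ a
  nextGo-insert-other h a y c v [] v≢a v≢y | yes c≡a =
    trans (nextGo-skip c≢v) (trans (nextGo-skip[] (λ y≡v → v≢y (sym y≡v))) (sym (nextGo-skip[] c≢v)))
    where c≢v = λ c≡v → v≢a (trans (sym c≡v) c≡a)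
  nextGo-insert-other h a y c v (d ∷ r) v≢a v≢y | yes c≡a =
    trans (nextGo-skip c≢v) (trans (nextGo-skip (λ y≡v → v≢y (sym y≡v))) (sym (nextGo-skip c≢v)))
    where c≢v = λ c≡v → v≢a (trans (sym c≡v) c≡a)
  nextGo-insert-other h a y c v [] v≢a v≢y | no _ = refl
  nextGo-insert-other h a y c v (d ∷ r) v≢a v≢y | no _ with c ≟ v
  ... | yes c≡v = trans (cong (nextGo h v c) (insertAfter-∷ a y d r)) (nextGo-hit c≡v)
  ... | no c≢v = begin
    nextGo h v c (insertAfter a y (d ∷ r))   ≡⟨ cong (nextGo h v c) (insertAfter-∷ a y d r) ⟩
    nextGo h v c (d ∷ insertTail a y d r)    ≡⟨ nextGo-skip c≢v ⟩
    nextGo h v d (insertTail a y d r)        ≡⟨ nextGo-insert-other h a y d v r v≢a v≢y ⟩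
    nextGo h v d r                           ∎
    where open ≡-Reasoning

  next-insert-anchor : ∀ (l : List (Fin n)) a y → a ∈ l → next (insertAfter a y l) a ≡ y
  next-insert-anchor (h ∷ t) a y a∈ rewrite insertAfter-∷ a y h t = nextGo-insert-anchor h a y h t a∈

  next-insert-new : ∀ (l : List (Fin n)) a y → a ∈ l → y ∉ l → next (insertAfter a y l) y ≡ next l a
  next-insert-new (h ∷ t) a y a∈ y∉ rewrite insertAfter-∷ a y h t = nextGo-insert-new h a y h t a∈ y∉

  next-insert-other : ∀ (l : List (Fin n)) a y v → ¬ v ≡ a → ¬ v ≡ y →
                      next (insertAfter a y l) v ≡ next l v
  next-insert-other [] a y v _ _ = refl
  next-insert-other (h ∷ t) a y v v≢a v≢y rewrite insertAfter-∷ a y h t = nextGo-insert-other h a y h v t v≢a v≢y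

  ∈-insert⁺ : ∀ {z : Fin n} a y (l : List (Fin n)) → z ∈ l → z ∈ insertAfter a y l
  ∈-insert⁺ a y (c ∷ r) z∈ with c ≟ a | z∈
  ... | yes _ | here z≡c = here z≡c
  ... | yes _ | there z∈r = there (there z∈r)
  ... | no _ | here z≡c = here z≡c
  ... | no _ | there z∈r = there (∈-insert⁺ a y r z∈r)

  ∈-insert-new : ∀ (a y : Fin n) (l : List (Fin n)) → a ∈ l → y ∈ insertAfter a y l
  ∈-insert-new a y (c ∷ r) a∈ with c ≟ a
  ... | yes _ = there (here refl)
  ... | no c≢a = there (∈-insert-new a y r (∈-tail a∈ c≢a))

  ∈-insert⁻ : ∀ {z : Fin n} a y (l : List (Fin n)) → z ∈ insertAfter a y l → z ∈ l ⊎ z ≡ y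
  ∈-insert⁻ a y (c ∷ r) z∈ with c ≟ a | z∈
  ... | yes _ | here z≡c = inj₁ (here z≡c)
  ... | yes _ | there (here z≡y) = inj₂ z≡y
  ... | yes _ | there (there z∈r) = inj₁ (there z∈r)
  ... | no _ | here z≡c = inj₁ (here z≡c)
  ... | no _ | there z∈ with ∈-insert⁻ a y r z∈
  ...   | inj₁ z∈r = inj₁ (there z∈r)
  ...   | inj₂ z≡y = inj₂ z≡y

  unique-insert : ∀ (a y : Fin n) (l : List (Fin n)) → Unique l → y ∉ l → Unique (insertAfter a y l)
  unique-insert a y [] _ _ = []
  unique-insert a y (c ∷ r) (c∉r ∷ u) y∉ with c ≟ a
  ... | yes _ = ((λ c≡y → y∉ (here (sym c≡y))) ∷ c∉r) ∷ (¬Any⇒All¬ r (λ y∈r → y∉ (there y∈r)) ∷ u)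
  ... | no _ = ¬Any⇒All¬ (insertAfter a y r) c∉ins ∷ unique-insert a y r u (λ y∈r → y∉ (there y∈r))
    where
    c∉ins : c ∉ insertAfter a y r
    c∉ins c∈ with ∈-insert⁻ a y r c∈
    ... | inj₁ c∈r = Unique[x∷xs]⇒x∉xs (c∉r ∷ u) c∈r
    ... | inj₂ c≡y = y∉ (here (sym c≡y))

-- 2. Orbits of a function, and how they change under the local surgery that
--    describes an edge insertion.

module Orbit {D : Set} where

  iter-suc : ∀ (f : D → D) k x → iter f (suc k) x ≡ iter f k (f x)
  iter-suc f zero x = refl
  iter-suc f (suc k) x = cong f (iter-suc f k x)

  iter-+ : ∀ (f : D → D) k l x → iter f (k + l) x ≡ iter f k (iter f l x)
  iter-+ f zero l x = refl
  iter-+ f (suc k) l x = cong f (iter-+ f k l x)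

  -- t lies on the forward f-orbit of s  (SameFace R is Reach (φ R))
  Reach : (D → D) → D → D → Set
  Reach f s t = ∃ λ k → iter f k s ≡ t

  reach-refl : ∀ {f s} → Reach f s s
  reach-refl = 0 , refl

  reach-trans : ∀ {f s t u} → Reach f s t → Reach f t u → Reach f s u
  reach-trans {f} {s} (k , p) (l , q) = l + k , trans (iter-+ f l k s) (trans (cong (iter f l) p) q)

  reach-step : ∀ {f s t u} → Reach f s t → f t ≡ u → Reach f s u
  reach-step (k , p) q = suc k , trans (cong _ p) q

  module Periodic (f : D → D) (periodic : ∀ e → ∃ λ p → iter f (suc p) e ≡ e) where

    reach-back : ∀ e → Reach f (f e) e
    reach-back e with periodic e
    ... | p , cycle = p , trans (sym (iter-suc f p e)) cycle

    reach-sym : ∀ {s t} → Reach f s t → Reach f t s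
    reach-sym {s} (zero , refl) = reach-refl
    reach-sym {s} (suc k , refl) = reach-trans (reach-back (iter f k s)) (reach-sym (k , refl))

  module Surgery (_≟D_ : DecidableEquality D) (f g : D → D) (Q : D → Set) (A B X Y : D)
    (Q-closed : ∀ {e} → Q e → Q (f e))
    (gA : g A ≡ X) (gX : g X ≡ f B) (gB : g B ≡ Y) (gY : g Y ≡ f A)
    (agree : ∀ {e} → Q e → ¬ e ≡ A → ¬ e ≡ B → g e ≡ f e)
    (periodic : ∀ e → ∃ λ p → iter f (suc p) e ≡ e) where

    open Periodic f periodic

    Q-iter : ∀ {d} → Q d → ∀ k → Q (iter f k d)
    Q-iter q zero = q
    Q-iter q (suc k) = Q-closed (Q-iter q k)

    orbit-ind : (P : D → Set) → ∀ {d} → Q d → P d →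
                (∀ {e} → Q e → Reach f d e → P e → P (f e)) → ∀ {e} → Reach f d e → P e
    orbit-ind P {d} qd pd step (k , refl) = go k
      where
      go : ∀ k → P (iter f k d)
      go zero = pd
      go (suc k) = step (Q-iter qd k) (k , refl) (go k)

    split : Q A → ∀ {e} → Reach f A e → Reach g X e ⊎ Reach g Y e
    split qA r = orbit-ind P (Q-closed qA) (inj₂ (1 , gY)) step (reach-trans (reach-back A) r)
      where
      P : D → Set
      P e = Reach g X e ⊎ Reach g Y e
      step : ∀ {e} → Q e → Reach f (f A) e → P e → P (f e)
      step {e} qe _ pe with e ≟D A | e ≟D B
      ... | yes refl | _ = inj₂ (1 , gY)
      ... | no _ | yes refl = inj₁ (1 , gX)
      ... | no e≢A | no e≢B with pe
      ...   | inj₁ r = inj₁ (reach-step r (agree qe e≢A e≢B))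
      ...   | inj₂ r = inj₂ (reach-step r (agree qe e≢A e≢B))

    keep : ∀ {d} → Q d → (∀ {e} → Reach f d e → ¬ e ≡ A × ¬ e ≡ B) →
           ∀ {e} → Reach f d e → Reach g d e
    keep {d} qd avoid = orbit-ind (Reach g d) qd reach-refl step
      where
      step : ∀ {e} → Q e → Reach f d e → Reach g d e → Reach g d (f e)
      step qe rd r = reach-step r (agree qe (proj₁ (avoid rd)) (proj₂ (avoid rd)))

    around : ∀ {C} → Q C → (∀ {e} → Reach f (f C) e → ¬ e ≡ C → ¬ e ≡ A × ¬ e ≡ B) →
             Reach g (f C) C
    around {C} qC avoid = orbit-ind (Reach g (f C)) (Q-closed qC) reach-refl step (reach-back C)
      where
      step : ∀ {e} → Q e → Reach f (f C) e → Reach g (f C) e → Reach g (f C) (f e)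
      step {e} qe rf r with e ≟D C
      ... | yes refl = reach-refl
      ... | no e≢C = reach-step r (agree qe (proj₁ (avoid rf e≢C)) (proj₂ (avoid rf e≢C)))

    merge : ¬ Reach f A B → Q A → Q B → ∀ {d} → Q d → ∀ {e} → Reach f d e → Reach g d e
    merge A↛B qA qB {d} qd = orbit-ind (Reach g d) qd reach-refl step
      where
      B↛A : ¬ Reach f B A
      B↛A r = A↛B (reach-sym r)
      around-A : Reach g (f A) A
      around-A = around qA λ rf e≢A → e≢A , λ e≡B → A↛B (subst (Reach f A) e≡B (reach-trans (1 , refl) rf))
      around-B : Reach g (f B) B
      around-B = around qB λ rf e≢B → (λ e≡A → B↛A (subst (Reach f B) e≡A (reach-trans (1 , refl) rf))) , e≢B
      step : ∀ {e} → Q e → Reach f d e → Reach g d e → Reach g d (f e)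
      step {e} qe rd r with e ≟D A | e ≟D B
      ... | yes refl | _ =
        reach-step (reach-step (reach-trans (reach-step (reach-step r gA) gX) around-B) gB) gY
      ... | no _ | yes refl =
        reach-step (reach-step (reach-trans (reach-step (reach-step r gB) gY) around-A) gA) gX
      ... | no e≢A | no e≢B = reach-step r (agree qe e≢A e≢B)

-- 3. Finiteness: injective self-maps of a finite type are periodic, and
--    "some point of the orbit satisfies P" is decidable for decidable P.

module Finite where

  open Orbit using (iter-+)

  iter-injective : ∀ {D : Set} (f : D → D) → (∀ {x y} → f x ≡ f y → x ≡ y) →
                   ∀ k {x y} → iter f k x ≡ iter f k y → x ≡ y
  iter-injective f inj zero e = e
  iter-injective f inj (suc k) e = iter-injective f inj k (inj e)

  -- pigeonhole on the first N+1 iterates of e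
  periodic : ∀ {D : Set} {N} (enc : D → Fin N) → (∀ {d d'} → enc d ≡ enc d' → d ≡ d') →
             (f : D → D) → (∀ {x y} → f x ≡ f y → x ≡ y) → ∀ e → ∃ λ p → iter f (suc p) e ≡ e
  periodic {N = N} enc enc-inj f inj e with pigeonhole (n<1+n N) (λ i → enc (iter f (toℕ i) e))
  ... | i , j , i<j , eq = p , sym (iter-injective f inj (toℕ i) (trans (enc-inj eq) iter-j))
    where
    p = toℕ j ∸ suc (toℕ i)
    j≡i+p : toℕ j ≡ toℕ i + suc p
    j≡i+p = sym (trans (+-suc (toℕ i) p) (m+[n∸m]≡n i<j))
    iter-j : iter f (toℕ j) e ≡ iter f (toℕ i) (iter f (suc p) e)
    iter-j = trans (cong (λ t → iter f t e) j≡i+p) (iter-+ f (toℕ i) (suc p) e)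

  module _ {D : Set} (f : D → D) (d : D) (p : ℕ) (cycle : iter f (suc p) d ≡ d) where

    iter-multiple : ∀ q → iter f (q * suc p) d ≡ d
    iter-multiple zero = refl
    iter-multiple (suc q) =
      trans (iter-+ f (suc p) (q * suc p) d) (trans (cong (iter f (suc p)) (iter-multiple q)) cycle)

    iter-mod : ∀ k → iter f k d ≡ iter f (k % suc p) d
    iter-mod k = begin
      iter f k d                                              ≡⟨ cong (λ t → iter f t d) (m≡m%n+[m/n]*n k (suc p)) ⟩
      iter f (k % suc p + (k / suc p) * suc p) d              ≡⟨ iter-+ f (k % suc p) ((k / suc p) * suc p) d ⟩
      iter f (k % suc p) (iter f ((k / suc p) * suc p) d)     ≡⟨ cong (iter f (k % suc p)) (iter-multiple (k / suc p)) ⟩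
      iter f (k % suc p) d                                    ∎
      where open ≡-Reasoning

    -- only the first suc p iterates need to be inspected
    dec-∃-iter : (P : D → Set) → (∀ x → Dec (P x)) → Dec (∃ λ k → P (iter f k d))
    dec-∃-iter P P? with any? {P = λ (i : Fin (suc p)) → P (iter f (toℕ i) d)} (λ i → P? _)
    ... | yes (i , Pi) = yes (toℕ i , Pi)
    ... | no none = no λ { (k , Pk) → none (fromℕ< (m%n<n k (suc p)) , subst P (reduce k) Pk) }
      where
      reduce : ∀ k → iter f k d ≡ iter f (toℕ (fromℕ< (m%n<n k (suc p)))) d
      reduce k = trans (iter-mod k) (cong (λ t → iter f t d) (sym (toℕ-fromℕ< (m%n<n k (suc p)))))

-- 4. Faces of a rotation system and the effect of one edge insertion.

module Faces {n : ℕ} where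

  open CyclicList
  open Orbit
  open Finite

  -- rotation systems with duplicate-free cyclic lists and undirected edges;
  -- the part of WellFormed that is preserved by edge insertions
  Consistent : Rot n → Set
  Consistent R = (∀ v → Unique (R v)) × (∀ v w → EAdj R v w → EAdj R w v)

  wellFormed-consistent : ∀ {R} → WellFormed R → Consistent R
  wellFormed-consistent (unique , symmetric , _) = unique , symmetric

  Cofacial : Rot n → Fin n → Fin n → Set
  Cofacial R u w = ∃ λ d → IsDart R d × OnFace R d u × OnFace R d w

  _≟D_ : DecidableEquality (Dart n)
  _≟D_ = ≡-dec _≟_ _≟_

  -- face tracing is injective, since each cyclic successor is
  φ-injective : (R : Rot n) → Consistent R → ∀ {d d' : Dart n} → φ R d ≡ φ R d' → d ≡ d'
  φ-injective R (unique , _) {v , w} {v' , w'} eq with cong proj₁ eq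
  ... | refl = cong (_, w) (next-injective (R w) (unique w) v v' (cong proj₂ eq))

  φ-periodic : (R : Rot n) → Consistent R → ∀ e → ∃ λ p → iter (φ R) (suc p) e ≡ e
  φ-periodic R cons = periodic (λ { (v , w) → combine v w }) combine-inj (φ R) (φ-injective R cons)
    where
    combine-inj : ∀ {d d' : Dart n} → combine (proj₁ d) (proj₂ d) ≡ combine (proj₁ d') (proj₂ d') → d ≡ d'
    combine-inj {v , w} {v' , w'} eq =
      cong₂ _,_ (combine-injectiveˡ v w v' w' eq) (combine-injectiveʳ v w v' w' eq)

  Touches : Dart n → Fin n → Set
  Touches e v = proj₁ e ≡ v ⊎ proj₂ e ≡ v

  onFace-dec : (R : Rot n) → Consistent R → ∀ d v → Dec (OnFace R d v)
  onFace-dec R cons d v with φ-periodic R cons d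
  ... | p , cycle = dec-∃-iter (φ R) d p cycle (λ e → Touches e v) (λ e → (proj₁ e ≟ v) ⊎-dec (proj₂ e ≟ v))

  onFace : ∀ {R : Rot n} {s e v} → Reach (φ R) s e → Touches e v → OnFace R s v
  onFace (k , refl) t = k , t

  onFace-transfer : ∀ {R R' : Rot n} {d s} → (∀ {e} → Reach (φ R) d e → Reach (φ R') s e) →
                    ∀ {v} → OnFace R d v → OnFace R' s v
  onFace-transfer {R} {R'} sub (k , t) = onFace {R'} (sub (k , refl)) t

  module Insertion (R : Rot n) (cons : Consistent R) (x a y b : Fin n) (x≢y : ¬ x ≡ y)
                   (a∈Rx : a ∈ R x) (b∈Ry : b ∈ R y) (x≁y : ¬ EAdj R x y) where

    mv : Move n
    mv = x , a , y , b

    R' : Rot n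
    R' = apply R mv

    unique : ∀ v → Unique (R v)
    unique = proj₁ cons

    symmetric : ∀ v w → EAdj R v w → EAdj R w v
    symmetric = proj₂ cons

    y≁x : ¬ EAdj R y x
    y≁x y~x = x≁y (symmetric y x y~x)

    apply-x : R' x ≡ insertAfter a y (R x)
    apply-x with x ≟ x
    ... | yes _ = refl
    ... | no x≢x = ⊥-elim (x≢x refl)

    apply-y : R' y ≡ insertAfter b x (R y)
    apply-y with y ≟ x
    ... | yes y≡x = ⊥-elim (x≢y (sym y≡x))
    ... | no _ with y ≟ y
    ...   | yes _ = refl
    ...   | no y≢y = ⊥-elim (y≢y refl)

    apply-other : ∀ v → ¬ v ≡ x → ¬ v ≡ y → R' v ≡ R v
    apply-other v v≢x v≢y with v ≟ x
    ... | yes v≡x = ⊥-elim (v≢x v≡x)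
    ... | no _ with v ≟ y
    ...   | yes v≡y = ⊥-elim (v≢y v≡y)
    ...   | no _ = refl

    data Position (v : Fin n) : Set where
      at-x  : v ≡ x → Position v
      at-y  : v ≡ y → Position v
      other : ¬ v ≡ x → ¬ v ≡ y → Position v

    position : ∀ v → Position v
    position v with v ≟ x | v ≟ y
    ... | yes v≡x | _ = at-x v≡x
    ... | no _ | yes v≡y = at-y v≡y
    ... | no v≢x | no v≢y = other v≢x v≢y

    embedded-mono : ∀ {v w} → EAdj R v w → EAdj R' v w
    embedded-mono {v} {w} v~w with position v
    ... | at-x refl = subst (w ∈_) (sym apply-x) (∈-insert⁺ a y (R x) v~w)
    ... | at-y refl = subst (w ∈_) (sym apply-y) (∈-insert⁺ b x (R y) v~w)
    ... | other v≢x v≢y = subst (w ∈_) (sym (apply-other v v≢x v≢y)) v~w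

    x~y : EAdj R' x y
    x~y = subst (y ∈_) (sym apply-x) (∈-insert-new a y (R x) a∈Rx)

    y~x : EAdj R' y x
    y~x = subst (x ∈_) (sym apply-y) (∈-insert-new b x (R y) b∈Ry)

    -- the insertion preserves consistency (y ∉ R x and x ∉ R y keep the lists duplicate-free)
    consistent : Consistent R'
    consistent = unique' , symmetric'
      where
      unique' : ∀ v → Unique (R' v)
      unique' v with position v
      ... | at-x refl = subst Unique (sym apply-x) (unique-insert a y (R x) (unique x) x≁y)
      ... | at-y refl = subst Unique (sym apply-y) (unique-insert b x (R y) (unique y) y≁x)
      ... | other v≢x v≢y = subst Unique (sym (apply-other v v≢x v≢y)) (unique v)
      symmetric' : ∀ v w → EAdj R' v w → EAdj R' w v
      symmetric' v w v~w with position v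
      ... | at-x refl with ∈-insert⁻ a y (R x) (subst (w ∈_) apply-x v~w)
      ...   | inj₁ w∈ = embedded-mono (symmetric x w w∈)
      ...   | inj₂ refl = y~x
      symmetric' v w v~w | at-y refl with ∈-insert⁻ b x (R y) (subst (w ∈_) apply-y v~w)
      ...   | inj₁ w∈ = embedded-mono (symmetric y w w∈)
      ...   | inj₂ refl = x~y
      symmetric' v w v~w | other v≢x v≢y =
        embedded-mono (symmetric v w (subst (w ∈_) (apply-other v v≢x v≢y) v~w))

    A B X Y : Dart n
    A = a , x
    B = b , y
    X = x , y
    Y = y , x

    φA : φ R' A ≡ X
    φA = cong (x ,_) (trans (cong (λ l → next l a) apply-x) (next-insert-anchor (R x) a y a∈Rx))
    φX : φ R' X ≡ φ R B
    φX = cong (y ,_) (trans (cong (λ l → next l x) apply-y) (next-insert-new (R y) b x b∈Ry y≁x))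
    φB : φ R' B ≡ Y
    φB = cong (y ,_) (trans (cong (λ l → next l b) apply-y) (next-insert-anchor (R y) b x b∈Ry))
    φY : φ R' Y ≡ φ R A
    φY = cong (x ,_) (trans (cong (λ l → next l y) apply-x) (next-insert-new (R x) a y a∈Rx x≁y))

    dart-closed : ∀ {e} → IsDart R e → IsDart R (φ R e)
    dart-closed {v , w} v~w = next-∈ (R w) v (symmetric v w v~w)

    φ-agree : ∀ {e} → IsDart R e → ¬ e ≡ A → ¬ e ≡ B → φ R' e ≡ φ R e
    φ-agree {v , w} v~w e≢A e≢B with position w
    ... | at-x refl = cong (x ,_) (trans (cong (λ l → next l v) apply-x)
           (next-insert-other (R x) a y v (λ v≡a → e≢A (cong (_, x) v≡a))
                              (λ v≡y → x≁y (subst (_∈ R x) v≡y (symmetric v x v~w)))))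
    ... | at-y refl = cong (y ,_) (trans (cong (λ l → next l v) apply-y)
           (next-insert-other (R y) b x v (λ v≡b → e≢B (cong (_, y) v≡b))
                              (λ v≡x → y≁x (subst (_∈ R y) v≡x (symmetric v y v~w)))))
    ... | other w≢x w≢y = cong (w ,_) (cong (λ l → next l v) (apply-other w w≢x w≢y))

    open Surgery _≟D_ (φ R) (φ R') (IsDart R) A B X Y dart-closed φA φX φB φY φ-agree (φ-periodic R cons)
    open Periodic (φ R) (φ-periodic R cons) using (reach-sym)

    A-dart : IsDart R A
    A-dart = symmetric x a a∈Rx

    B-dart : IsDart R B
    B-dart = symmetric y b b∈Ry

    into-face-cofacial : IntoFace R mv → Cofacial R x y
    into-face-cofacial (zero , A≡B) = ⊥-elim (x≢y (cong proj₂ A≡B))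
    into-face-cofacial (suc k , A↝B) =
      (x , next (R x) a) , next-∈ (R x) a a∈Rx , (0 , inj₁ refl) ,
      (k , inj₂ (cong proj₂ (trans (sym (iter-suc (φ R) k A)) A↝B)))

    merged-cofacial : ¬ IntoFace R mv → ∀ {u w} → Cofacial R u w → Cofacial R' u w
    merged-cofacial A↛B (d , d-dart , on-u , on-w) =
      d , embedded-mono d-dart , grow on-u , grow on-w
      where
      grow : ∀ {v} → OnFace R d v → OnFace R' d v
      grow = onFace-transfer {R} {R'} (merge A↛B A-dart B-dart d-dart)

    split-face : ∀ {d} → Reach (φ R) d A → ∀ {v} → OnFace R d v → F₁ R mv v ⊎ F₂ R mv v
    split-face d↝A (k , t) with split A-dart (reach-trans (reach-sym d↝A) (k , refl))
    ... | inj₁ X↝ = inj₁ (onFace {R'} X↝ t)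
    ... | inj₂ Y↝ = inj₂ (onFace {R'} Y↝ t)

    split-cofacial : IntoFace R mv → ∀ {u w} → Cofacial R u w →
                     Cofacial R' u w ⊎ ((F₁ R mv u ⊎ F₂ R mv u) × (F₁ R mv w ⊎ F₂ R mv w))
    split-cofacial A↝B {u} {w} (d , d-dart , on-u , on-w)
      with φ-periodic R cons d
    ... | p , cycle with dec-∃-iter (φ R) d p cycle (λ e → e ≡ A ⊎ e ≡ B) (λ e → (e ≟D A) ⊎-dec (e ≟D B))
    ...   | yes (k , inj₁ at-A) = inj₂ (split-face (k , at-A) on-u , split-face (k , at-A) on-w)
    ...   | yes (k , inj₂ at-B) = inj₂ (split-face d↝A on-u , split-face d↝A on-w)
      where
      d↝A : Reach (φ R) d A
      d↝A = reach-trans (k , at-B) (reach-sym A↝B)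
    ...   | no avoids = inj₁ (d , embedded-mono d-dart , survive on-u , survive on-w)
      where
      survive : ∀ {v} → OnFace R d v → OnFace R' d v
      survive = onFace-transfer {R} {R'} (keep d-dart λ { (k , refl) →
                  (λ at-A → avoids (k , inj₁ at-A)) , (λ at-B → avoids (k , inj₂ at-B)) })

-- 5. The procedure.

propagate : ∀ {s m} (P : ℕ → Set) → (∀ i → s ≤ i → i < m → P i → P (suc i)) →
            ∀ {k} → s ≤ k → k ≤ m → P s → P k
propagate {s} {m} P step s≤k k≤m Ps = go (≤⇒≤′ s≤k) k≤m
  where
  go : ∀ {k} → s ≤′ k → k ≤ m → P k
  go ≤′-refl _ = Ps
  go (≤′-step s≤′k) k<m = step _ (≤′⇒≤ s≤′k) k<m (go s≤′k (≤-trans (n≤1+n _) k<m))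

exactly-one-each : ∀ {n} {P Q : Fin n → Set} {u w : Fin n} →
                   Dec (P u) → Dec (Q u) → Dec (P w) → Dec (Q w) →
                   ¬ (P u × P w) → ¬ (Q u × Q w) → ¬ ¬ ((P u ⊎ Q u) × (P w ⊎ Q w)) →
                   ExactlyOne (P ∖ Q) u w × ExactlyOne (Q ∖ P) u w
exactly-one-each (yes Pu) (yes Qu) _ _ notP notQ covered =
  ⊥-elim (covered λ { (_ , inj₁ Pw) → notP (Pu , Pw) ; (_ , inj₂ Qw) → notQ (Qu , Qw) })
exactly-one-each (no ¬Pu) (no ¬Qu) _ _ notP notQ covered =
  ⊥-elim (covered λ { (inj₁ Pu , _) → ¬Pu Pu ; (inj₂ Qu , _) → ¬Qu Qu })
exactly-one-each (yes Pu) (no ¬Qu) (yes Pw) _ notP notQ covered = ⊥-elim (notP (Pu , Pw))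
exactly-one-each (yes Pu) (no ¬Qu) (no ¬Pw) (no ¬Qw) notP notQ covered =
  ⊥-elim (covered λ { (_ , inj₁ Pw) → ¬Pw Pw ; (_ , inj₂ Qw) → ¬Qw Qw })
exactly-one-each (yes Pu) (no ¬Qu) (no ¬Pw) (yes Qw) notP notQ covered =
  inj₁ ((Pu , ¬Qu) , λ PQw → ¬Pw (proj₁ PQw)) , inj₂ ((λ QPu → ¬Qu (proj₁ QPu)) , (Qw , ¬Pw))
exactly-one-each (no ¬Pu) (yes Qu) _ (yes Qw) notP notQ covered = ⊥-elim (notQ (Qu , Qw))
exactly-one-each (no ¬Pu) (yes Qu) (no ¬Pw) (no ¬Qw) notP notQ covered =
  ⊥-elim (covered λ { (_ , inj₁ Pw) → ¬Pw Pw ; (_ , inj₂ Qw) → ¬Qw Qw })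
exactly-one-each (no ¬Pu) (yes Qu) (yes Pw) (no ¬Qw) notP notQ covered =
  inj₂ ((λ PQu → ¬Pu (proj₁ PQu)) , (Pw , ¬Qw)) , inj₁ ((Qu , ¬Pu) , λ QPw → ¬Qw (proj₁ QPw))

module Procedure {n} (G : Graph n) (R₀ : Rot n) (cons₀ : Faces.Consistent R₀)
                 (ms : ℕ → Move n) (m : ℕ)
                 (valid : ∀ i → i < m → ValidStep G (stage R₀ ms i) (ms i)) where

  open Faces

  S : ℕ → Rot n
  S = stage R₀ ms

  module Step (i : ℕ) (i<m : i < m) (cons : Consistent (S i)) where
    private
      vs : ValidStep G (S i) (ms i)
      vs = valid i i<m
      x y : Fin n
      x = proj₁ (ms i)
      y = proj₁ (proj₂ (proj₂ (ms i)))
      x≢y : ¬ x ≡ y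
      x≢y x≡y = noLoops G (subst (Adj G x) (sym x≡y) (proj₁ vs))
    open Insertion (S i) cons x (proj₁ (proj₂ (ms i))) y (proj₂ (proj₂ (proj₂ (ms i)))) x≢y
                   (proj₁ (proj₂ (proj₂ vs))) (proj₁ (proj₂ (proj₂ (proj₂ vs)))) (proj₁ (proj₂ vs)) public

    no-critical : IntoFace (S i) (ms i) → ∀ u w → ¬ Critical G (S i) u w
    no-critical into = proj₂ (proj₂ (proj₂ (proj₂ vs))) λ crit → proj₂ (proj₂ crit) (into-face-cofacial into)

  consistent-stage : ∀ {i} → i ≤ m → Consistent (S i)
  consistent-stage i≤m =
    propagate (λ i → Consistent (S i)) (λ i _ i<m cons → Step.consistent i i<m cons) z≤n i≤m cons₀

  consistent-at-step : ∀ i → i < m → Consistent (S i)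
  consistent-at-step i i<m = consistent-stage (≤-trans (n≤1+n i) i<m)

  embedded-persists : ∀ {i u w} → i ≤ m → EAdj (S i) u w → EAdj (S m) u w
  embedded-persists {i} {u} {w} i≤m =
    propagate (λ k → EAdj (S k) u w) (λ k _ k<m → Step.embedded-mono k k<m (consistent-at-step k k<m)) i≤m ≤-refl

  cofacial-persists : ∀ {j u w} → j < m →
                      (∀ j′ → j < j′ → j′ < m → ¬ IntoFace (S j′) (ms j′)) →
                      Cofacial (S (suc j)) u w → Cofacial (S m) u w
  cofacial-persists {j} {u} {w} j<m last =
    propagate (λ k → Cofacial (S k) u w)
              (λ k j<k k<m → Step.merged-cofacial k k<m (consistent-at-step k k<m) (last k j<k k<m)) j<m ≤-refl

-- The theorem.
lemma1 : ∀ {n} (G : Graph n) → Connected G →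
         (R₀ : Rot n) → SpanningTreeEmb G R₀ →
         (ms : ℕ → Move n) (m : ℕ) →
         (∀ i → i < m → ValidStep G (stage R₀ ms i) (ms i)) →
         HasCycle (stage R₀ ms m) →
         (j : ℕ) → j < m → IntoFace (stage R₀ ms j) (ms j) →
         (∀ j′ → j < j′ → j′ < m → ¬ IntoFace (stage R₀ ms j′) (ms j′)) →
         (u w : Fin n) → Critical G (stage R₀ ms m) u w →
         ExactlyOne (F₁ (stage R₀ ms j) (ms j) ∖ F₂ (stage R₀ ms j) (ms j)) u w
         × ExactlyOne (F₂ (stage R₀ ms j) (ms j) ∖ F₁ (stage R₀ ms j) (ms j)) u w
lemma1 G _ R₀ tree ms m valid _ j j<m into last u w (u~w , u≁w , not-cofacial-m) =
  exactly-one-each {P = F₁ (S j) (ms j)} {Q = F₂ (S j) (ms j)}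
                   (dec X u) (dec Y u) (dec X w) (dec Y w)
                   (λ { (F₁u , F₁w) → separated (X , x~y , F₁u , F₁w) })
                   (λ { (F₂u , F₂w) → separated (Y , y~x , F₂u , F₂w) })
                   covered
  where
  open Faces
  open Procedure G R₀ (wellFormed-consistent (proj₁ tree)) ms m valid
  open Step j j<m (consistent-at-step j j<m)
  dec : ∀ d v → Dec (OnFace (S (suc j)) d v)
  dec = onFace-dec (S (suc j)) (consistent-stage j<m)
  -- u and w share no face after step j, since faces only merge afterwards ...
  separated : ¬ Cofacial (S (suc j)) u w
  separated c = not-cofacial-m (cofacial-persists j<m last c)
  -- ... but they shared one before step j, as {u , w} was not critical there
  cofacial-before : ¬ ¬ Cofacial (S j) u w
  cofacial-before ¬c =
    no-critical into u w (u~w , (λ u~w-j → u≁w (embedded-persists (≤-trans (n≤1+n j) j<m) u~w-j)) , ¬c)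
  -- so that face was the split one
  covered : ¬ ¬ ((F₁ (S j) (ms j) u ⊎ F₂ (S j) (ms j) u) × (F₁ (S j) (ms j) w ⊎ F₂ (S j) (ms j) w))
  covered ¬F = cofacial-before λ c → [ separated , ¬F ]′ (split-cofacial into c)
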